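{- If $T$ is a ditree and $H$ is a digraph, then $\gamma(T\mathbin{\Box} H)\ge\gamma(T)\gamma(H)$.
   Context: All digraphs are finite, and their arc relation is irreflexive. A ditree is a digraph whose underlying graph (the undirected graph in which $u,v$ are adjacent iff $uv$ or $vu$ is an arc) is a tree. A set $S\subseteq V(D)$ is dominating if every vertex not in $S$ is an out-neighbor of some vertex of $S$; $\gamma(D)$ is the minimum size of a dominating set. The Cartesian product $G\mathbin{\Box} H$ has vertex set $V(G)\times V(H)$, with an arc from $(g_1,h_1)$ to $(g_2,h_2)$ iff either $g_1=g_2$ and $h_1h_2\in A(H)$, or $h_1=h_2$ and $g_1g_2\in A(G)$. -}

module Defs where

open import Data.Nat using (ℕ; _*_; _≤_)
open import Data.Bool using (Bool; true; false; _∧_; _∨_)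
open import Data.Bool.Properties using (∧-zeroʳ)
open import Data.Fin using (Fin; remQuot; _≟_)
open import Data.Fin.Subset using (Subset; _∈_; ∣_∣)
open import Data.Product using (Σ; ∃; _×_; _,_; proj₁; proj₂)
open import Data.Sum using (_⊎_)
open import Data.List using (List; _∷_; []; _++_; [_]; length)
open import Data.List.Relation.Unary.Linked using (Linked)
open import Data.List.Relation.Unary.Unique.Propositional using (Unique)
open import Relation.Nullary using (¬_)
open import Relation.Nullary.Decidable using (⌊_⌋)
open import Relation.Binary.PropositionalEquality using (_≡_; refl)

record Digraph : Set where
  field
    size   : ℕ
    arc    : Fin size → Fin size → Bool
    irrefl : ∀ v → arc v v ≡ false
open Digraph public

Arc : (D : Digraph) → Fin (size D) → Fin (size D) → Set
Arc D u v = arc D u v ≡ true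

IsDominating : (D : Digraph) → Subset (size D) → Set
IsDominating D S = ∀ v → v ∈ S ⊎ ∃ λ u → u ∈ S × Arc D u v

IsDominationNumber : Digraph → ℕ → Set
IsDominationNumber D k =
  (Σ (Subset (size D)) λ S → IsDominating D S × ∣ S ∣ ≡ k)
  × (∀ S → IsDominating D S → k ≤ ∣ S ∣)

Adj : (D : Digraph) → Fin (size D) → Fin (size D) → Set
Adj D u v = Arc D u v ⊎ Arc D v u

data Walk (D : Digraph) : Fin (size D) → Fin (size D) → Set where
  here  : ∀ {u} → Walk D u u
  there : ∀ {u v w} → Adj D u v → Walk D v w → Walk D u w

Connected : Digraph → Set
Connected D = ∀ u v → Walk D u v

HasCycle : Digraph → Set
HasCycle D = Σ (Fin (size D)) λ x → Σ (List (Fin (size D))) λ xs →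
  (3 ≤ length (x ∷ xs)) × Unique (x ∷ xs) × Linked (Adj D) ((x ∷ xs) ++ [ x ])

IsDitree : Digraph → Set
IsDitree D = (1 ≤ size D) × Connected D × ¬ HasCycle D

-- Cartesian product; vertex (g , h) is encoded as combine g h : Fin (m * n)
-- (decoded by remQuot, its inverse)
private
  pairArc : (G H : Digraph) → Fin (size G) × Fin (size H) → Fin (size G) × Fin (size H) → Bool
  pairArc G H (g₁ , h₁) (g₂ , h₂) =
    (⌊ g₁ ≟ g₂ ⌋ ∧ arc H h₁ h₂) ∨ (⌊ h₁ ≟ h₂ ⌋ ∧ arc G g₁ g₂)

  pairIrrefl : (G H : Digraph) → ∀ x → pairArc G H x x ≡ false
  pairIrrefl G H (g , h) rewrite irrefl H h | irrefl G g
    | ∧-zeroʳ ⌊ g ≟ g ⌋ | ∧-zeroʳ ⌊ h ≟ h ⌋ = refl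

_□_ : Digraph → Digraph → Digraph
G □ H = record
  { size   = size G * size H
  ; arc    = λ p q → pairArc G H (remQuot (size H) p) (remQuot (size H) q)
  ; irrefl = λ p → pairIrrefl G H (remQuot (size H) p)
  }

-- If the closed in-neighbourhoods N⁻[p] of the vertices p in a list P of G are pairwise
-- disjoint, every dominating set D of G □ H has at least |P|·γ(H) elements: the part of D
-- lying over N⁻[p] projects onto a dominating set of H, and these parts of D are disjoint.
-- In a ditree such a P exists together with a dominating set S with |S| ≤ |P|, built greedily
-- from the set R of vertices still to be dominated. A leaf r of R reaches the rest of R within
-- two steps only through one neighbour q, so x = q (if q → r) or x = r dominates r and every
-- p ∈ R whose closed in-neighbourhood meets N⁻[r]. Put r into P and x into S, and recurse on R
-- minus the closed out-neighbourhood of x.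
module Submission where

open import Defs
open import Data.Nat using (ℕ; zero; suc; _+_; _*_; _≤_; _<_; z≤n; s≤s)
open import Data.Nat.Properties
  using ( ≤-refl; ≤-trans; ≤-reflexive; <-≤-trans; <⇒≱; ≮⇒≥; n≤1+n
        ; +-suc; +-identityʳ; +-mono-≤; +-monoˡ-≤; +-monoʳ-≤; *-monoˡ-≤; m≤n+m
        ; module ≤-Reasoning )
  renaming (_<?_ to _<ℕ?_)
import Data.Bool as Bool
open import Data.Bool using (true; false)
import Data.Fin as Fin
open import Data.Fin using (Fin; zero; suc; remQuot; combine)
open import Data.Fin.Properties using (_≟_; any?; pigeonhole; remQuot-combine)
open import Data.Fin.Subset
  using (Subset; _∈_; _⊆_; _⊂_; ∣_∣; ⊤; ⁅_⁆; _∪_; _∩_; ∁; ⋃; Nonempty; inside; outside)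
  renaming (⊥ to ∅)
open import Data.Fin.Subset.Properties
  using ( _∈?_; nonempty?; ∉⊥; ∈⊤; x∈⁅x⁆; ∣⊥∣≡0; ∣⁅x⁆∣≡1; ∣p∣≤∣x∷p∣; ∣p∩q∣≤∣p∣
        ; p⊆q⇒∣p∣≤∣q∣; p∩q⊆p; x∈p∩q⁺; x∈p∩q⁻; x∈p∪q⁺; x∈p∪q⁻; x∈∁p⇒x∉p; x∉p⇒x∈∁p )
open import Data.Fin.Subset.Induction using (⊂-wellFounded)
open import Induction.WellFounded using (Acc; acc)
open import Data.Vec using ([]; _∷_; here; there; tabulate)
open import Data.Vec.Properties using (lookup⇒[]=; []=⇒lookup; lookup∘tabulate)
open import Data.List using (List; []; _∷_; _++_; [_]; length; lookup; map)
open import Data.List.Properties using (++-assoc; length-++)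
open import Data.List.Relation.Unary.All as All using (All; []; _∷_)
open import Data.List.Relation.Unary.All.Properties
  using (¬Any⇒All¬; ++⁻ˡ) renaming (map⁺ to All-map⁺)
open import Data.List.Relation.Unary.AllPairs using (AllPairs; []; _∷_)
open import Data.List.Relation.Unary.Any using (here; there)
open import Data.List.Relation.Unary.Linked using (Linked; []; [-]; _∷_)
open import Data.List.Relation.Unary.Unique.Propositional using (Unique)
open import Data.List.Membership.Propositional using () renaming (_∈_ to _∈ₗ_; _∉_ to _∉ₗ_)
open import Data.List.Membership.Propositional.Properties using (∈-∃++; ∈-lookup)
open import Data.Product using (∃; ∃₂; _×_; _,_; proj₁; proj₂)
open import Data.Sum using (_⊎_; inj₁; inj₂; swap) renaming (map₂ to ⊎-map₂)
open import Data.Empty using (⊥; ⊥-elim)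
open import Function using (_∘_)
open import Relation.Nullary using (¬_; Dec; yes; no; does; contradiction)
open import Relation.Nullary.Decidable using (dec-true; ¬?; _×-dec_; _⊎-dec_)
open import Relation.Unary using (Pred; Decidable)
open import Relation.Binary.PropositionalEquality using (_≡_; _≢_; refl; sym; trans; cong; subst)

private
  variable
    k l n : ℕ

subsetOf : ∀ {ℓ} {P : Pred (Fin n) ℓ} → Decidable P → Subset n
subsetOf P? = tabulate (λ i → does (P? i))

module _ {ℓ} {P : Pred (Fin n) ℓ} (P? : Decidable P) where

  ∈-subsetOf⁺ : ∀ {i} → P i → i ∈ subsetOf P?
  ∈-subsetOf⁺ {i} p =
    lookup⇒[]= i _ (trans (lookup∘tabulate (λ j → does (P? j)) i) (dec-true (P? i) p))

  ∈-subsetOf⁻ : ∀ {i} → i ∈ subsetOf P? → P i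
  ∈-subsetOf⁻ {i} i∈
    with P? i | trans (sym (lookup∘tabulate (λ j → does (P? j)) i)) ([]=⇒lookup i∈)
  ... | yes p | _ = p
  ... | no _  | ()

Disjoint : Subset n → Subset n → Set
Disjoint p q = ∀ {x} → x ∈ p → x ∈ q → ⊥

drop-∷-Disjoint : ∀ {s t} {p q : Subset n} → Disjoint (s ∷ p) (t ∷ q) → Disjoint p q
drop-∷-Disjoint p#q x∈p x∈q = p#q (there x∈p) (there x∈q)

Disjoint-⋃ : ∀ {p : Subset n} {qs} → All (Disjoint p) qs → Disjoint p (⋃ qs)
Disjoint-⋃ []            _   x∈∅ = ∉⊥ x∈∅
Disjoint-⋃ (p#q ∷ p#qs) x∈p x∈⋃ with x∈p∪q⁻ _ _ x∈⋃
... | inj₁ x∈q  = p#q x∈p x∈q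
... | inj₂ x∈qs = Disjoint-⋃ p#qs x∈p x∈qs

∣p∪q∣≤∣p∣+∣q∣ : (p q : Subset n) → ∣ p ∪ q ∣ ≤ ∣ p ∣ + ∣ q ∣
∣p∪q∣≤∣p∣+∣q∣ []            []            = z≤n
∣p∪q∣≤∣p∣+∣q∣ (inside  ∷ p) (t ∷ q)       =
  s≤s (≤-trans (∣p∪q∣≤∣p∣+∣q∣ p q) (+-monoʳ-≤ ∣ p ∣ (∣p∣≤∣x∷p∣ t q)))
∣p∪q∣≤∣p∣+∣q∣ (outside ∷ p) (inside  ∷ q) =
  ≤-trans (s≤s (∣p∪q∣≤∣p∣+∣q∣ p q)) (≤-reflexive (sym (+-suc ∣ p ∣ ∣ q ∣)))
∣p∪q∣≤∣p∣+∣q∣ (outside ∷ p) (outside ∷ q) = ∣p∪q∣≤∣p∣+∣q∣ p q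

∣p∣+∣q∣≤∣p∪q∣ : (p q : Subset n) → Disjoint p q → ∣ p ∣ + ∣ q ∣ ≤ ∣ p ∪ q ∣
∣p∣+∣q∣≤∣p∪q∣ []            []            _   = z≤n
∣p∣+∣q∣≤∣p∪q∣ (inside  ∷ p) (inside  ∷ q) p#q = ⊥-elim (p#q here here)
∣p∣+∣q∣≤∣p∪q∣ (inside  ∷ p) (outside ∷ q) p#q =
  s≤s (∣p∣+∣q∣≤∣p∪q∣ p q (drop-∷-Disjoint p#q))
∣p∣+∣q∣≤∣p∪q∣ (outside ∷ p) (inside  ∷ q) p#q =
  ≤-trans (≤-reflexive (+-suc ∣ p ∣ ∣ q ∣)) (s≤s (∣p∣+∣q∣≤∣p∪q∣ p q (drop-∷-Disjoint p#q)))
∣p∣+∣q∣≤∣p∪q∣ (outside ∷ p) (outside ∷ q) p#q = ∣p∣+∣q∣≤∣p∪q∣ p q (drop-∷-Disjoint p#q)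

∩∁-⊂ : ∀ {p q : Subset n} {x} → x ∈ p → x ∈ q → p ∩ ∁ q ⊂ p
∩∁-⊂ {p = p} {q} {x} x∈p x∈q =
  p∩q⊆p p (∁ q) , x , x∈p , λ x∈p∩∁q → x∈∁p⇒x∉p (proj₂ (x∈p∩q⁻ p (∁ q) x∈p∩∁q)) x∈q

image : (Fin k → Fin l) → Subset k → Subset l
image f []            = ∅
image f (inside  ∷ p) = ⁅ f zero ⁆ ∪ image (f ∘ suc) p
image f (outside ∷ p) = image (f ∘ suc) p

∣image∣≤∣p∣ : (f : Fin k → Fin l) (p : Subset k) → ∣ image f p ∣ ≤ ∣ p ∣
∣image∣≤∣p∣ {l = l} f []            = ≤-reflexive (∣⊥∣≡0 l)
∣image∣≤∣p∣           f (inside  ∷ p) =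
  ≤-trans (∣p∪q∣≤∣p∣+∣q∣ ⁅ f zero ⁆ (image (f ∘ suc) p))
          (+-mono-≤ (≤-reflexive (∣⁅x⁆∣≡1 (f zero))) (∣image∣≤∣p∣ (f ∘ suc) p))
∣image∣≤∣p∣           f (outside ∷ p) = ∣image∣≤∣p∣ (f ∘ suc) p

∈-image⁺ : (f : Fin k → Fin l) (p : Subset k) {x : Fin k} → x ∈ p → f x ∈ image f p
∈-image⁺ f (inside  ∷ p) here        = x∈p∪q⁺ (inj₁ (x∈⁅x⁆ (f zero)))
∈-image⁺ f (inside  ∷ p) (there x∈p) = x∈p∪q⁺ (inj₂ (∈-image⁺ (f ∘ suc) p x∈p))
∈-image⁺ f (outside ∷ p) (there x∈p) = ∈-image⁺ (f ∘ suc) p x∈p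

module _ {A : Set} where

  Unique⇒lookup-≢ : {xs : List A} → Unique xs → ∀ {i j} → i Fin.< j → lookup xs i ≢ lookup xs j
  Unique⇒lookup-≢ (x∉xs ∷ _)    {zero}  {suc j} _         = All.lookup x∉xs (∈-lookup j)
  Unique⇒lookup-≢ (_    ∷ uniq) {suc i} {suc j} (s≤s i<j) = Unique⇒lookup-≢ uniq i<j

  Unique-prefix : ∀ (xs : List A) {y ys} → Unique (xs ++ y ∷ ys) → Unique (xs ++ [ y ])
  Unique-prefix []       (_     ∷ _)    = [] ∷ []
  Unique-prefix (x ∷ xs) {y} {ys} (x∉ ∷ uniq) =
    ++⁻ˡ (xs ++ [ y ]) (subst (All (x ≢_)) (sym (++-assoc xs [ y ] ys)) x∉)
    ∷ Unique-prefix xs uniq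

  Linked-close : ∀ {R : A → A → Set} {x y z ys} (xs : List A) →
                 Linked R (x ∷ xs ++ y ∷ ys) → R y z → Linked R (x ∷ (xs ++ [ y ]) ++ [ z ])
  Linked-close []       (x~y  ∷ _)      y~z = x~y ∷ y~z ∷ [-]
  Linked-close (_ ∷ xs) (x~x′ ∷ linked) y~z = x~x′ ∷ Linked-close xs linked y~z

Unique⇒length≤ : {xs : List (Fin n)} → Unique xs → length xs ≤ n
Unique⇒length≤ {n} {xs} uniq with n <ℕ? length xs
... | no  n≮len = ≮⇒≥ n≮len
... | yes n<len with pigeonhole n<len (lookup xs)
...   | _ , _ , i<j , same = ⊥-elim (Unique⇒lookup-≢ uniq i<j same)

module _ (G : Digraph) where

  Arc-irrefl : ∀ {u} → ¬ Arc G u u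
  Arc-irrefl {u} u→u with () ← trans (sym (irrefl G u)) u→u

  Adj-irrefl : ∀ {u} → ¬ Adj G u u
  Adj-irrefl (inj₁ u→u) = Arc-irrefl u→u
  Adj-irrefl (inj₂ u→u) = Arc-irrefl u→u

  Adj-sym : ∀ {u v} → Adj G u v → Adj G v u
  Adj-sym = swap

  Adj? : ∀ u v → Dec (Adj G u v)
  Adj? u v = (arc G u v Bool.≟ true) ⊎-dec (arc G v u Bool.≟ true)

  Dominates : Fin (size G) → Fin (size G) → Set
  Dominates u v = u ≡ v ⊎ Arc G u v

  Dominates? : ∀ u v → Dec (Dominates u v)
  Dominates? u v = (u ≟ v) ⊎-dec (arc G u v Bool.≟ true)

  inNbhd : Fin (size G) → Subset (size G)
  inNbhd v = subsetOf (λ u → Dominates? u v)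

  outNbhd : Fin (size G) → Subset (size G)
  outNbhd u = subsetOf (Dominates? u)

  ∈-inNbhd⁺ : ∀ {u v} → Dominates u v → u ∈ inNbhd v
  ∈-inNbhd⁺ {v = v} = ∈-subsetOf⁺ (λ u → Dominates? u v)

  ∈-inNbhd⁻ : ∀ {u v} → u ∈ inNbhd v → Dominates u v
  ∈-inNbhd⁻ {v = v} = ∈-subsetOf⁻ (λ u → Dominates? u v)

  ∈-outNbhd⁺ : ∀ {u v} → Dominates u v → v ∈ outNbhd u
  ∈-outNbhd⁺ {u} = ∈-subsetOf⁺ (Dominates? u)

  ∈-outNbhd⁻ : ∀ {u v} → v ∈ outNbhd u → Dominates u v
  ∈-outNbhd⁻ {u} = ∈-subsetOf⁻ (Dominates? u)

  InPacking : List (Fin (size G)) → Set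
  InPacking = AllPairs (λ p q → Disjoint (inNbhd p) (inNbhd q))

  dominating⁺ : ∀ {S} → (∀ v → ∃ λ s → s ∈ S × Dominates s v) → IsDominating G S
  dominating⁺ S-dom v with S-dom v
  ... | s , s∈S , inj₁ refl = inj₁ s∈S
  ... | s , s∈S , inj₂ s→v  = inj₂ (s , s∈S , s→v)

module _ (G H : Digraph) where

  π₁ : Fin (size (G □ H)) → Fin (size G)
  π₁ i = proj₁ (remQuot {size G} (size H) i)

  π₂ : Fin (size (G □ H)) → Fin (size H)
  π₂ i = proj₂ (remQuot {size G} (size H) i)

  □-arc⁻ : ∀ {u v} → Arc (G □ H) u v →
           (π₁ u ≡ π₁ v × Arc H (π₂ u) (π₂ v)) ⊎ (π₂ u ≡ π₂ v × Arc G (π₁ u) (π₁ v))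
  □-arc⁻ {u} {v} u→v with π₁ u ≟ π₁ v | π₂ u ≟ π₂ v | arc H (π₂ u) (π₂ v)
  ... | yes g≡g | _       | true  = inj₁ (g≡g , refl)
  ... | yes _   | yes h≡h | false = inj₂ (h≡h , u→v)
  ... | no _    | yes h≡h | _     = inj₂ (h≡h , u→v)

  cylinder : Subset (size G) → Subset (size (G □ H))
  cylinder A = subsetOf (λ i → π₁ i ∈? A)

  ∈-cylinder⁺ : ∀ {A i} → π₁ i ∈ A → i ∈ cylinder A
  ∈-cylinder⁺ {A} = ∈-subsetOf⁺ (λ i → π₁ i ∈? A)

  ∈-cylinder⁻ : ∀ {A i} → i ∈ cylinder A → π₁ i ∈ A
  ∈-cylinder⁻ {A} = ∈-subsetOf⁻ (λ i → π₁ i ∈? A)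

  module _ (D : Subset (size (G □ H))) (D-dom : IsDominating (G □ H) D) where

    weight : Subset (size G) → ℕ
    weight A = ∣ D ∩ cylinder A ∣

    weight-∪ : ∀ {A B} → Disjoint A B → weight A + weight B ≤ weight (A ∪ B)
    weight-∪ {A} {B} A#B =
      ≤-trans (∣p∣+∣q∣≤∣p∪q∣ _ _ fibres-disjoint) (p⊆q⇒∣p∣≤∣q∣ fibres-∪)
      where
      over : ∀ {C i} → i ∈ D ∩ cylinder C → π₁ i ∈ C
      over i∈ = ∈-cylinder⁻ (proj₂ (x∈p∩q⁻ D _ i∈))

      fibres-disjoint : Disjoint (D ∩ cylinder A) (D ∩ cylinder B)
      fibres-disjoint i∈A i∈B = A#B (over i∈A) (over i∈B)

      fibres-∪ : D ∩ cylinder A ∪ D ∩ cylinder B ⊆ D ∩ cylinder (A ∪ B)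
      fibres-∪ {i} i∈ with x∈p∪q⁻ _ _ i∈
      ... | inj₁ i∈A = x∈p∩q⁺ (proj₁ (x∈p∩q⁻ D _ i∈A) , ∈-cylinder⁺ (x∈p∪q⁺ (inj₁ (over i∈A))))
      ... | inj₂ i∈B = x∈p∩q⁺ (proj₁ (x∈p∩q⁻ D _ i∈B) , ∈-cylinder⁺ (x∈p∪q⁺ (inj₂ (over i∈B))))

    module _ {b} (b≤ : ∀ S → IsDominating H S → b ≤ ∣ S ∣) where

      b≤weight-inNbhd : ∀ r → b ≤ weight (inNbhd G r)
      b≤weight-inNbhd r = ≤-trans (b≤ Y Y-dom) (∣image∣≤∣p∣ π₂ (D ∩ cylinder (inNbhd G r)))
        where
        Y : Subset (size H)
        Y = image π₂ (D ∩ cylinder (inNbhd G r))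

        Dominated : Fin (size H) → Set
        Dominated h = h ∈ Y ⊎ ∃ λ h′ → h′ ∈ Y × Arc H h′ h

        ∈Y : ∀ {u} → u ∈ D → Dominates G (π₁ u) r → π₂ u ∈ Y
        ∈Y u∈D u≤r = ∈-image⁺ π₂ _ (x∈p∩q⁺ (u∈D , ∈-cylinder⁺ (∈-inNbhd⁺ G u≤r)))

        fibre-dominated : ∀ v → π₁ v ≡ r → Dominated (π₂ v)
        fibre-dominated v v≡r with D-dom v
        ... | inj₁ v∈D = inj₁ (∈Y v∈D (inj₁ v≡r))
        ... | inj₂ (u , u∈D , u→v) with □-arc⁻ u→v
        ...   | inj₁ (g≡g , h→h) = inj₂ (π₂ u , ∈Y u∈D (inj₁ (trans g≡g v≡r)) , h→h)
        ...   | inj₂ (h≡h , g→g) =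
          inj₁ (subst (_∈ Y) h≡h (∈Y u∈D (inj₂ (subst (Arc G (π₁ u)) v≡r g→g))))

        Y-dom : IsDominating H Y
        Y-dom h = subst Dominated (cong proj₂ (remQuot-combine r h))
          (fibre-dominated (combine r h) (cong proj₁ (remQuot-combine r h)))

      in-packing-weight : ∀ {ps} → InPacking G ps →
                          length ps * b ≤ weight (⋃ (map (inNbhd G) ps))
      in-packing-weight {[]}     []               = z≤n
      in-packing-weight {p ∷ ps} (p#ps ∷ packing) = begin
        b + length ps * b
          ≤⟨ +-mono-≤ (b≤weight-inNbhd p) (in-packing-weight packing) ⟩
        weight (inNbhd G p) + weight (⋃ (map (inNbhd G) ps))
          ≤⟨ weight-∪ (Disjoint-⋃ (All-map⁺ p#ps)) ⟩
        weight (inNbhd G p ∪ ⋃ (map (inNbhd G) ps)) ∎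
        where open ≤-Reasoning

      in-packing*γ≤∣D∣ : ∀ {ps} → InPacking G ps → length ps * b ≤ ∣ D ∣
      in-packing*γ≤∣D∣ packing = ≤-trans (in-packing-weight packing) (∣p∩q∣≤∣p∣ D _)

module _ (T : Digraph) (acyclic : ¬ HasCycle T) where

  open import Data.List.Membership.DecPropositional (_≟_ {size T})
    using () renaming (_∈?_ to _∈ₗ?_)

  no-chord : ∀ {w v y zs} → Unique (w ∷ v ∷ zs) → Linked (Adj T) (w ∷ v ∷ zs) →
             y ∈ₗ zs → ¬ Adj T y w
  no-chord {w} {v} {y} uniq linked y∈zs y~w with ∈-∃++ y∈zs
  ... | as , _ , refl = acyclic
    (w , v ∷ as ++ [ y ] , s≤s (s≤s (subst (1 ≤_) (sym (length-++ as)) (m≤n+m 1 (length as))))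
       , Unique-prefix (w ∷ v ∷ as) uniq , Linked-close (v ∷ as) linked y~w)

  Leaf : Subset (size T) → Fin (size T) → Fin (size T) → Set
  Leaf R r q = ∀ {p u} → p ∈ R → p ≢ r → Adj T r u → u ≡ p ⊎ Adj T u p → u ≡ q

  -- A leaf is found by extending a path whose vertices of R follow each other at distance at
  -- most two; where the path gets stuck, acyclicity makes its end a leaf with the previous
  -- vertex as stem.
  module _ (R : Subset (size T)) where

    Extension : Fin (size T) → List (Fin (size T)) → Fin (size T) → Fin (size T) → Set
    Extension r xs u r′ =
      r′ ∈ R × u ∉ₗ r ∷ xs × r′ ∉ₗ r ∷ xs × Adj T r u × (u ≡ r′ ⊎ Adj T u r′)

    extension? : ∀ r xs → Dec (∃₂ (Extension r xs))
    extension? r xs = any? λ u → any? λ r′ →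
      (r′ ∈? R) ×-dec ¬? (u ∈ₗ? r ∷ xs) ×-dec ¬? (r′ ∈ₗ? r ∷ xs)
      ×-dec Adj? T r u ×-dec ((u ≟ r′) ⊎-dec Adj? T u r′)

    path-extend : ∀ {r xs u r′} → Extension r xs u r′ →
                  Unique (r ∷ xs) → Linked (Adj T) (r ∷ xs) →
                  ∃ λ ys → Unique (r′ ∷ ys) × Linked (Adj T) (r′ ∷ ys)
                         × length (r ∷ xs) < length (r′ ∷ ys)
    path-extend {r} {xs} (_ , u∉ , _ , r~u , inj₁ refl) uniq linked =
      r ∷ xs , ¬Any⇒All¬ _ u∉ ∷ uniq , Adj-sym T r~u ∷ linked , ≤-refl
    path-extend {r} {xs} {u} (_ , u∉ , r′∉ , r~u , inj₂ u~r′) uniq linked =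
      u ∷ r ∷ xs
      , ((λ { refl → Adj-irrefl T u~r′ }) ∷ ¬Any⇒All¬ _ r′∉) ∷ ¬Any⇒All¬ _ u∉ ∷ uniq
      , Adj-sym T u~r′ ∷ Adj-sym T r~u ∷ linked
      , n≤1+n _

    previous : Fin (size T) → List (Fin (size T)) → Fin (size T)
    previous r []      = r  -- arbitrary: r then has no route to the rest of R
    previous _ (q ∷ _) = q

    stuck⇒Leaf : ∀ {r xs} → Unique (r ∷ xs) → Linked (Adj T) (r ∷ xs) → ¬ ∃₂ (Extension r xs) →
                 Leaf R r (previous r xs)
    stuck⇒Leaf {r} {xs} uniq linked stuck {p} {u} p∈R p≢r r~u u≈p with u ∈ₗ? r ∷ xs
    ... | yes (here refl)          = ⊥-elim (Adj-irrefl T r~u)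
    ... | yes (there (here refl))  = refl
    ... | yes (there (there u∈zs)) = ⊥-elim (no-chord uniq linked u∈zs (Adj-sym T r~u))
    ... | no u∉ with p ∈ₗ? r ∷ xs
    ...   | no p∉             = ⊥-elim (stuck (u , p , p∈R , u∉ , p∉ , r~u , u≈p))
    ...   | yes (here refl)   = ⊥-elim (p≢r refl)
    ...   | yes (there p∈xs) with u≈p
    ...     | inj₁ refl = ⊥-elim (u∉ (there p∈xs))
    ...     | inj₂ u~p  =
      ⊥-elim (no-chord (¬Any⇒All¬ _ u∉ ∷ uniq) (Adj-sym T r~u ∷ linked) p∈xs (Adj-sym T u~p))

    -- k is fuel: a path has at most size T vertices.
    grow : ∀ k r xs → r ∈ R → Unique (r ∷ xs) → Linked (Adj T) (r ∷ xs) →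
           size T < length (r ∷ xs) + k → ∃₂ λ r q → r ∈ R × Leaf R r q
    grow zero    r xs _   uniq _      long =
      ⊥-elim (<⇒≱ (subst (size T <_) (+-identityʳ _) long) (Unique⇒length≤ uniq))
    grow (suc k) r xs r∈R uniq linked long with extension? r xs
    ... | no stuck = r , previous r xs , r∈R , stuck⇒Leaf uniq linked stuck
    ... | yes (_ , r′ , ext) with path-extend ext uniq linked
    ...   | ys , uniq′ , linked′ , longer = grow k r′ ys (proj₁ ext) uniq′ linked′
      (<-≤-trans (subst (size T <_) (+-suc (length (r ∷ xs)) k) long) (+-monoˡ-≤ k longer))

    leaf-exists : Nonempty R → ∃₂ λ r q → r ∈ R × Leaf R r q
    leaf-exists (r , r∈R) = grow (size T) r [] r∈R ([] ∷ []) [-] ≤-refl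

  leaf-common-dominator : ∀ {R r q p g} → Leaf R r q → p ∈ R → p ≢ r →
                          Dominates T g r → Dominates T g p →
                          (g ≡ r × q ≡ p) ⊎ (g ≡ q × Arc T q r)
  leaf-common-dominator leaf p∈R p≢r (inj₁ refl) (inj₁ refl) = ⊥-elim (p≢r refl)
  leaf-common-dominator leaf p∈R p≢r (inj₁ refl) (inj₂ r→p)  =
    inj₁ (refl , sym (leaf p∈R p≢r (inj₁ r→p) (inj₁ refl)))
  leaf-common-dominator leaf p∈R p≢r (inj₂ g→r)  g≤p
    with refl ← leaf p∈R p≢r (inj₂ g→r) (⊎-map₂ inj₁ g≤p) = inj₂ (refl , g→r)

  Absorbs : Subset (size T) → Fin (size T) → Fin (size T) → Set
  Absorbs R r x = ∀ {p g} → p ∈ R → Dominates T g r → Dominates T g p → Dominates T x p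

  leaf-dominator : ∀ {R r q} → Leaf R r q → ∃ λ x → Dominates T x r × Absorbs R r x
  leaf-dominator {R} {r} {q} leaf with arc T q r in q→r
  ... | true = q , inj₂ q→r , via-stem
    where
    via-stem : Absorbs R r q
    via-stem {p} p∈R g≤r g≤p with p ≟ r
    ... | yes refl = inj₂ q→r
    ... | no p≢r with leaf-common-dominator leaf p∈R p≢r g≤r g≤p
    ...   | inj₁ (_ , q≡p) = inj₁ q≡p
    ...   | inj₂ (refl , _) = g≤p
  ... | false = r , inj₁ refl , via-leaf
    where
    via-leaf : Absorbs R r r
    via-leaf {p} p∈R g≤r g≤p with p ≟ r
    ... | yes refl = inj₁ refl
    ... | no p≢r with leaf-common-dominator leaf p∈R p≢r g≤r g≤p
    ...   | inj₁ (refl , _) = g≤p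
    ...   | inj₂ (_ , q→r′) = contradiction (trans (sym q→r) q→r′) λ ()

  record DominatorsAndPacking (R : Subset (size T)) : Set where
    field
      dominators : Subset (size T)
      packing    : List (Fin (size T))
      dominate   : ∀ {w} → w ∈ R → ∃ λ s → s ∈ dominators × Dominates T s w
      packing⊆R  : All (_∈ R) packing
      in-packing : InPacking T packing
      size-bound : ∣ dominators ∣ ≤ length packing

  add-leaf : ∀ {R r x} → r ∈ R → Absorbs R r x →
             DominatorsAndPacking (R ∩ ∁ (outNbhd T x)) → DominatorsAndPacking R
  add-leaf {R} {r} {x} r∈R absorbs rest = record
    { dominators = ⁅ x ⁆ ∪ dominators
    ; packing    = r ∷ packing
    ; dominate   = dominate′
    ; packing⊆R  = r∈R ∷ All.map (p∩q⊆p R _) packing⊆R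
    ; in-packing = All.map separated packing⊆R ∷ in-packing
    ; size-bound = ≤-trans (∣p∪q∣≤∣p∣+∣q∣ ⁅ x ⁆ dominators)
                           (+-mono-≤ (≤-reflexive (∣⁅x⁆∣≡1 x)) size-bound)
    }
    where
    open DominatorsAndPacking rest

    dominate′ : ∀ {w} → w ∈ R → ∃ λ s → s ∈ ⁅ x ⁆ ∪ dominators × Dominates T s w
    dominate′ {w} w∈R with Dominates? T x w
    ... | yes x≤w = x , x∈p∪q⁺ (inj₁ (x∈⁅x⁆ x)) , x≤w
    ... | no  x≰w with dominate (x∈p∩q⁺ (w∈R , x∉p⇒x∈∁p (x≰w ∘ ∈-outNbhd⁻ T)))
    ...   | s , s∈S , s≤w = s , x∈p∪q⁺ (inj₂ s∈S) , s≤w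

    separated : ∀ {p} → p ∈ R ∩ ∁ (outNbhd T x) → Disjoint (inNbhd T r) (inNbhd T p)
    separated {p} p∈ g∈r g∈p with x∈p∩q⁻ R _ p∈
    ... | p∈R , p∉N⁺[x] =
      x∈∁p⇒x∉p p∉N⁺[x] (∈-outNbhd⁺ T (absorbs p∈R (∈-inNbhd⁻ T g∈r) (∈-inNbhd⁻ T g∈p)))

  dominators-and-packing : ∀ R → Acc _⊂_ R → DominatorsAndPacking R
  dominators-and-packing R (acc smaller) with nonempty? R
  ... | no R-empty = record
    { dominators = ∅ ; packing = [] ; dominate = λ w∈R → ⊥-elim (R-empty (_ , w∈R))
    ; packing⊆R = [] ; in-packing = [] ; size-bound = ≤-reflexive (∣⊥∣≡0 (size T)) }
  ... | yes R-nonempty with leaf-exists R R-nonempty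
  ...   | r , _ , r∈R , leaf with leaf-dominator leaf
  ...     | x , x≤r , absorbs = add-leaf r∈R absorbs
    (dominators-and-packing _ (smaller (∩∁-⊂ r∈R (∈-outNbhd⁺ T x≤r))))

  dominating-set-and-in-packing :
    ∃₂ λ S ps → IsDominating T S × InPacking T ps × ∣ S ∣ ≤ length ps
  dominating-set-and-in-packing =
    dominators , packing , dominating⁺ T (λ v → dominate ∈⊤) , in-packing , size-bound
    where open DominatorsAndPacking (dominators-and-packing ⊤ (⊂-wellFounded ⊤))

corollary6p1 : (T H : Digraph) → IsDitree T →
    ∀ a b c → IsDominationNumber T a → IsDominationNumber H b →
    IsDominationNumber (T □ H) c → a * b ≤ c
corollary6p1 T H (_ , _ , acyclic) a b c (_ , a≤) (_ , b≤) ((D , D-dom , refl) , _)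
  with dominating-set-and-in-packing T acyclic
... | S , ps , S-dom , packing , ∣S∣≤ = begin
  a * b         ≤⟨ *-monoˡ-≤ b (a≤ S S-dom) ⟩
  ∣ S ∣ * b     ≤⟨ *-monoˡ-≤ b ∣S∣≤ ⟩
  length ps * b ≤⟨ in-packing*γ≤∣D∣ T H D D-dom b≤ packing ⟩
  ∣ D ∣         ∎
  where open ≤-Reasoning
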